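{- Let $m\ge 0$ be an integer, $k=4m+3$, and $f(x,z)=\lfloor\frac{x+z}{k}\rfloor$ for non-negative integers $x,z$. Let $x,y,z$ be non-negative integers with $x\oplus y\oplus z=0$ and $y\le f(x,z)$. Then: (1) $u\oplus y\oplus z\neq 0$ for every integer $0\le u<x$; (2) $u\oplus v\oplus z\neq 0$ for all integers $0\le u<x$, $0\le v<y$ with $v=f(u,z)$; (3) $x\oplus v\oplus z\neq 0$ for every integer $0\le v<y$; (4) $x\oplus y\oplus w\neq 0$ for every integer $0\le w<z$ with $y\le f(x,w)$; (5) $x\oplus v\oplus w\neq 0$ for all integers $0\le v<y$, $0\le w<z$ with $v=f(x,w)$.
   Context: $\oplus$ denotes nim-sum: the bitwise XOR of binary expansions of non-negative integers. -}

module Defs where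

open import Data.Nat using (ℕ; zero; suc; _+_; _*_; _/_; _%_)
open import Data.Bool using (Bool; true; false; _xor_)

bit : ℕ → Bool
bit n with n % 2
... | zero = false
... | suc _ = true

fromBit : Bool → ℕ
fromBit true = 1
fromBit false = 0

-- Bitwise XOR with a fuel argument; fuel ≥ number of binary digits suffices.
xorFuel : ℕ → ℕ → ℕ → ℕ
xorFuel zero    a b = 0
xorFuel (suc f) a b = fromBit (bit a xor bit b) + 2 * xorFuel f (a / 2) (b / 2)

-- Nim-sum (bitwise XOR). Fuel a + b is always enough (a, b < 2^(a+b)).
infixl 6 _⊕_
_⊕_ : ℕ → ℕ → ℕ
a ⊕ b = xorFuel (a + b) a b

fk : ℕ → ℕ → ℕ → ℕ
fk m x z = (x + z) / suc (4 * m + 2)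

{-# OPTIONS --safe #-}
module Submission where

-- Since x ⊕ y = z, we have x + z = y + 2 (x ∖ y), where x ∖ y keeps the bits of x that are not bits
-- of y. With j = 2m + 1, the hypothesis y ≤ f(x, z) thus says j y ≤ x ∖ y, and v = f(u, z') for
-- u ⊕ v = z' says u ∖ v ≤ j (v + 1). Parts (1), (3) and (4) are cancellation for ⊕. In (2) and (5),
-- either u = x or u ⊕ v = x ⊕ y, so x and u agree above the highest bit where y and v differ; dropping
-- the bits below it keeps both bounds, and there y = 2t + 1, v = 2t, x ∖ y = 2a ≤ u ∖ v, whence
-- j y ≤ 2a ≤ j y: an even number equal to an odd one.

open import Defs
open import Data.Nat using (ℕ; _≤_; _<_)
open import Data.Product using (_×_)
open import Relation.Binary.PropositionalEquality using (_≡_; _≢_)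
open import Data.Nat using (zero; suc; _+_; _*_; _/_; _%_; z≤n; s≤s; _≟_; NonZero)
open import Data.Nat.Properties
open import Data.Nat.DivMod
open import Data.Nat.Divisibility using (divides)
open import Data.Nat.Tactic.RingSolver using (solve-∀)
open import Data.Bool using (Bool; true; false; _xor_; _∧_; not)
open import Data.Bool.Properties using (xor-same; xor-comm; ∧-zeroʳ)
open import Data.Product using (_,_; proj₁; proj₂)
open import Data.Sum using (_⊎_; inj₁; inj₂; [_,_])
open import Data.Empty using (⊥)
open import Relation.Nullary using (yes; no)
open import Function using (_∘_)
open import Relation.Binary.PropositionalEquality
  using (refl; sym; trans; cong; cong₂; subst; subst₂; module ≡-Reasoning)

infixr 5 _∷ᵇ_
_∷ᵇ_ : Bool → ℕ → ℕ
b ∷ᵇ n = fromBit b + 2 * n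

fromBit-bit : ∀ n → fromBit (bit n) ≡ n % 2
fromBit-bit n with n % 2 | m%n<n n 2
... | zero        | _ = refl
... | suc zero    | _ = refl
... | suc (suc _) | s≤s (s≤s ())

fromBit≤1 : ∀ b → fromBit b ≤ 1
fromBit≤1 true  = s≤s z≤n
fromBit≤1 false = z≤n

fromBit-injective : ∀ {p q} → fromBit p ≡ fromBit q → p ≡ q
fromBit-injective {true}  {true}  _ = refl
fromBit-injective {false} {false} _ = refl

fromBit%2 : ∀ b → fromBit b % 2 ≡ fromBit b
fromBit%2 true  = refl
fromBit%2 false = refl

fromBit/2 : ∀ b → fromBit b / 2 ≡ 0
fromBit/2 true  = refl
fromBit/2 false = refl

bit∷ᵇhalf : ∀ n → bit n ∷ᵇ n / 2 ≡ n
bit∷ᵇhalf n = begin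
  fromBit (bit n) + 2 * (n / 2) ≡⟨ cong₂ _+_ (fromBit-bit n) (*-comm 2 (n / 2)) ⟩
  n % 2 + n / 2 * 2             ≡⟨ sym (m≡m%n+[m/n]*n n 2) ⟩
  n                             ∎
  where open ≡-Reasoning

bit-∷ᵇ : ∀ b n → bit (b ∷ᵇ n) ≡ b
bit-∷ᵇ b n = fromBit-injective (begin
  fromBit (bit (b ∷ᵇ n))  ≡⟨ fromBit-bit (b ∷ᵇ n) ⟩
  (fromBit b + 2 * n) % 2 ≡⟨ cong (λ t → (fromBit b + t) % 2) (*-comm 2 n) ⟩
  (fromBit b + n * 2) % 2 ≡⟨ [m+kn]%n≡m%n (fromBit b) n 2 ⟩
  fromBit b % 2           ≡⟨ fromBit%2 b ⟩
  fromBit b               ∎)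
  where open ≡-Reasoning

half-∷ᵇ : ∀ b n → (b ∷ᵇ n) / 2 ≡ n
half-∷ᵇ b n = begin
  (fromBit b + 2 * n) / 2   ≡⟨ cong (λ t → (fromBit b + t) / 2) (*-comm 2 n) ⟩
  (fromBit b + n * 2) / 2   ≡⟨ +-distrib-/-∣ʳ (fromBit b) (divides n refl) ⟩
  fromBit b / 2 + n * 2 / 2 ≡⟨ cong₂ _+_ (fromBit/2 b) (m*n/n≡m n 2) ⟩
  n                         ∎
  where open ≡-Reasoning

∷ᵇ-injective : ∀ {b c m n} → b ∷ᵇ m ≡ c ∷ᵇ n → b ≡ c × m ≡ n
∷ᵇ-injective {b} {c} {m} {n} e =
  trans (sym (bit-∷ᵇ b m)) (trans (cong bit e) (bit-∷ᵇ c n)) ,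
  trans (sym (half-∷ᵇ b m)) (trans (cong (_/ 2) e) (half-∷ᵇ c n))

≡-by-bit-half : ∀ {m n} → bit m ≡ bit n → m / 2 ≡ n / 2 → m ≡ n
≡-by-bit-half {m} {n} b≡ h≡ = begin
  m                 ≡⟨ sym (bit∷ᵇhalf m) ⟩
  bit m ∷ᵇ m / 2    ≡⟨ cong₂ _∷ᵇ_ b≡ h≡ ⟩
  bit n ∷ᵇ n / 2    ≡⟨ bit∷ᵇhalf n ⟩
  n                 ∎
  where open ≡-Reasoning

∷ᵇ≤1+2* : ∀ b n → b ∷ᵇ n ≤ 1 + 2 * n
∷ᵇ≤1+2* b n = +-monoˡ-≤ (2 * n) (fromBit≤1 b)

m≤1+n⇒m/2≤n : ∀ {m n} → m ≤ suc n → m / 2 ≤ n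
m≤1+n⇒m/2≤n {m} {n} m≤1+n = ≤-pred (begin-strict
  m / 2     ≤⟨ /-monoˡ-≤ 2 m≤1+n ⟩
  suc n / 2 <⟨ m/n<m (suc n) 2 (s≤s (s≤s z≤n)) ⟩
  suc n     ∎)
  where open ≤-Reasoning

bitwiseFuel : (Bool → Bool → Bool) → ℕ → ℕ → ℕ → ℕ
bitwiseFuel op zero    a b = 0
bitwiseFuel op (suc f) a b = op (bit a) (bit b) ∷ᵇ bitwiseFuel op f (a / 2) (b / 2)

bitwise : (Bool → Bool → Bool) → ℕ → ℕ → ℕ
bitwise op a b = bitwiseFuel op (a + b) a b

xorFuel≗bitwiseFuel : ∀ f a b → xorFuel f a b ≡ bitwiseFuel _xor_ f a b
xorFuel≗bitwiseFuel zero    a b = refl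
xorFuel≗bitwiseFuel (suc f) a b = cong ((bit a xor bit b) ∷ᵇ_) (xorFuel≗bitwiseFuel f (a / 2) (b / 2))

module _ (op : Bool → Bool → Bool) (op-false : op false false ≡ false) where

  bitwiseFuel-0-0 : ∀ f → bitwiseFuel op f 0 0 ≡ 0
  bitwiseFuel-0-0 zero    = refl
  bitwiseFuel-0-0 (suc f) rewrite op-false | bitwiseFuel-0-0 f = refl

  bitwiseFuel-irrelevant : ∀ f g {a b} → a ≤ f → b ≤ f → a ≤ g → b ≤ g →
                           bitwiseFuel op f a b ≡ bitwiseFuel op g a b
  bitwiseFuel-irrelevant zero g z≤n z≤n _ _ = sym (bitwiseFuel-0-0 g)
  bitwiseFuel-irrelevant (suc f) zero _ _ z≤n z≤n = bitwiseFuel-0-0 (suc f)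
  bitwiseFuel-irrelevant (suc f) (suc g) {a} {b} a≤f b≤f a≤g b≤g =
    cong (op (bit a) (bit b) ∷ᵇ_)
      (bitwiseFuel-irrelevant f g (m≤1+n⇒m/2≤n a≤f) (m≤1+n⇒m/2≤n b≤f) (m≤1+n⇒m/2≤n a≤g) (m≤1+n⇒m/2≤n b≤g))

  bitwise-unfold : ∀ a b → bitwise op a b ≡ op (bit a) (bit b) ∷ᵇ bitwise op (a / 2) (b / 2)
  bitwise-unfold a b = begin
    bitwiseFuel op (a + b) a b
      ≡⟨ bitwiseFuel-irrelevant (a + b) (suc (a + b)) a≤a+b b≤a+b (m≤n⇒m≤1+n a≤a+b) (m≤n⇒m≤1+n b≤a+b) ⟩
    op (bit a) (bit b) ∷ᵇ bitwiseFuel op (a + b) (a / 2) (b / 2)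
      ≡⟨ cong (op (bit a) (bit b) ∷ᵇ_) (bitwiseFuel-irrelevant (a + b) (a / 2 + b / 2)
           (≤-trans (m/n≤m a 2) a≤a+b) (≤-trans (m/n≤m b 2) b≤a+b)
           (m≤m+n (a / 2) (b / 2)) (m≤n+m (b / 2) (a / 2))) ⟩
    op (bit a) (bit b) ∷ᵇ bitwise op (a / 2) (b / 2)
      ∎
    where
    open ≡-Reasoning
    a≤a+b : a ≤ a + b
    a≤a+b = m≤m+n a b
    b≤a+b : b ≤ a + b
    b≤a+b = m≤n+m b a

⊕-unfold : ∀ a b → a ⊕ b ≡ (bit a xor bit b) ∷ᵇ (a / 2 ⊕ b / 2)
⊕-unfold a b = begin
  xorFuel (a + b) a b                              ≡⟨ xorFuel≗bitwiseFuel (a + b) a b ⟩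
  bitwise _xor_ a b                                ≡⟨ bitwise-unfold _xor_ refl a b ⟩
  (bit a xor bit b) ∷ᵇ bitwise _xor_ (a / 2) (b / 2)
    ≡⟨ cong ((bit a xor bit b) ∷ᵇ_) (sym (xorFuel≗bitwiseFuel (a / 2 + b / 2) (a / 2) (b / 2))) ⟩
  (bit a xor bit b) ∷ᵇ (a / 2 ⊕ b / 2)             ∎
  where open ≡-Reasoning

⊕-half : ∀ a b → (a ⊕ b) / 2 ≡ a / 2 ⊕ b / 2
⊕-half a b = trans (cong (_/ 2) (⊕-unfold a b)) (half-∷ᵇ (bit a xor bit b) (a / 2 ⊕ b / 2))

⊕-comm : ∀ a b → a ⊕ b ≡ b ⊕ a
⊕-comm a b = bounded (a + b) (m≤m+n a b) (m≤n+m b a)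
  where
  bounded : ∀ n {a b} → a ≤ n → b ≤ n → a ⊕ b ≡ b ⊕ a
  bounded zero    z≤n z≤n = refl
  bounded (suc n) {a} {b} a≤ b≤ = begin
    a ⊕ b                                ≡⟨ ⊕-unfold a b ⟩
    (bit a xor bit b) ∷ᵇ (a / 2 ⊕ b / 2) ≡⟨ cong₂ _∷ᵇ_ (xor-comm (bit a) (bit b))
                                              (bounded n (m≤1+n⇒m/2≤n a≤) (m≤1+n⇒m/2≤n b≤)) ⟩
    (bit b xor bit a) ∷ᵇ (b / 2 ⊕ a / 2) ≡⟨ sym (⊕-unfold b a) ⟩
    b ⊕ a                                ∎
    where open ≡-Reasoning

⊕-self : ∀ n → n ⊕ n ≡ 0
⊕-self n = bounded n ≤-refl
  where
  bounded : ∀ k {n} → n ≤ k → n ⊕ n ≡ 0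
  bounded zero    z≤n = refl
  bounded (suc k) {n} n≤ = trans (⊕-unfold n n)
    (cong₂ _∷ᵇ_ (xor-same (bit n)) (bounded k (m≤1+n⇒m/2≤n n≤)))

xor-cancelʳ : ∀ {p q} r → p xor r ≡ q xor r → p ≡ q
xor-cancelʳ {true}  {true}  _     _  = refl
xor-cancelʳ {false} {false} _     _  = refl
xor-cancelʳ {true}  {false} true  ()
xor-cancelʳ {true}  {false} false ()
xor-cancelʳ {false} {true}  true  ()
xor-cancelʳ {false} {true}  false ()

⊕-cancelʳ : ∀ a b c → a ⊕ c ≡ b ⊕ c → a ≡ b
⊕-cancelʳ a b c = bounded (a + b + c) (≤-trans (m≤m+n a b) (m≤m+n (a + b) c))
  (≤-trans (m≤n+m b a) (m≤m+n (a + b) c)) (m≤n+m c (a + b))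
  where
  bounded : ∀ n {a b c} → a ≤ n → b ≤ n → c ≤ n → a ⊕ c ≡ b ⊕ c → a ≡ b
  bounded zero    z≤n z≤n _ _ = refl
  bounded (suc n) {a} {b} {c} a≤ b≤ c≤ e =
    let bits , halves = ∷ᵇ-injective (trans (sym (⊕-unfold a c)) (trans e (⊕-unfold b c)))
    in ≡-by-bit-half (xor-cancelʳ (bit c) bits)
         (bounded n (m≤1+n⇒m/2≤n a≤) (m≤1+n⇒m/2≤n b≤) (m≤1+n⇒m/2≤n c≤) halves)

⊕-cancelˡ : ∀ a b c → c ⊕ a ≡ c ⊕ b → a ≡ b
⊕-cancelˡ a b c e = ⊕-cancelʳ a b c (trans (⊕-comm a c) (trans e (⊕-comm c b)))

⊕≡0⇒≡ : ∀ {a b} → a ⊕ b ≡ 0 → a ≡ b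
⊕≡0⇒≡ {a} {b} e = ⊕-cancelʳ a b b (trans e (sym (⊕-self b)))

infixl 6 _∖_
_∖_ : ℕ → ℕ → ℕ
_∖_ = bitwise (λ p q → p ∧ not q)

∖-unfold : ∀ a b → a ∖ b ≡ (bit a ∧ not (bit b)) ∷ᵇ (a / 2 ∖ b / 2)
∖-unfold = bitwise-unfold _ refl

fromBit-+-xor : ∀ p q → fromBit p + fromBit (p xor q) ≡ fromBit q + 2 * fromBit (p ∧ not q)
fromBit-+-xor true  true  = refl
fromBit-+-xor true  false = refl
fromBit-+-xor false true  = refl
fromBit-+-xor false false = refl

m+[m⊕n]≡n+2*[m∖n] : ∀ a b → a + (a ⊕ b) ≡ b + 2 * (a ∖ b)
m+[m⊕n]≡n+2*[m∖n] a b = bounded (a + b) (m≤m+n a b) (m≤n+m b a)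
  where
  regroup₁ : ∀ w x y z → (w + 2 * x) + (y + 2 * z) ≡ (w + y) + 2 * (x + z)
  regroup₁ = solve-∀
  regroup₂ : ∀ w x y z → (w + 2 * x) + 2 * (y + 2 * z) ≡ (w + 2 * y) + 2 * (x + 2 * z)
  regroup₂ = solve-∀

  bounded : ∀ n {a b} → a ≤ n → b ≤ n → a + (a ⊕ b) ≡ b + 2 * (a ∖ b)
  bounded zero    z≤n z≤n = refl
  bounded (suc n) {a} {b} a≤ b≤ = begin
    a + (a ⊕ b)
      ≡⟨ cong₂ _+_ (sym (bit∷ᵇhalf a)) (⊕-unfold a b) ⟩
    (fromBit p + 2 * a′) + (fromBit (p xor q) + 2 * (a′ ⊕ b′))
      ≡⟨ regroup₁ (fromBit p) a′ (fromBit (p xor q)) (a′ ⊕ b′) ⟩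
    (fromBit p + fromBit (p xor q)) + 2 * (a′ + (a′ ⊕ b′))
      ≡⟨ cong₂ _+_ (fromBit-+-xor p q) (cong (2 *_) (bounded n (m≤1+n⇒m/2≤n a≤) (m≤1+n⇒m/2≤n b≤))) ⟩
    (fromBit q + 2 * fromBit (p ∧ not q)) + 2 * (b′ + 2 * (a′ ∖ b′))
      ≡⟨ regroup₂ (fromBit q) (fromBit (p ∧ not q)) b′ (a′ ∖ b′) ⟩
    (fromBit q + 2 * b′) + 2 * (fromBit (p ∧ not q) + 2 * (a′ ∖ b′))
      ≡⟨ cong₂ _+_ (bit∷ᵇhalf b) (cong (2 *_) (sym (∖-unfold a b))) ⟩
    b + 2 * (a ∖ b)
      ∎
    where
    open ≡-Reasoning
    p q : Bool
    p = bit a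
    q = bit b
    a′ b′ : ℕ
    a′ = a / 2
    b′ = b / 2

m⊕n≡o⇒m+o≡n+2*[m∖n] : ∀ x y {z} → x ⊕ y ≡ z → x + z ≡ y + 2 * (x ∖ y)
m⊕n≡o⇒m+o≡n+2*[m∖n] x y refl = m+[m⊕n]≡n+2*[m∖n] x y

m<suc[m/n]*n : ∀ m n .{{_ : NonZero n}} → m < suc (m / n) * n
m<suc[m/n]*n m n = begin-strict
  m                 ≡⟨ m≡m%n+[m/n]*n m n ⟩
  m % n + m / n * n <⟨ +-monoˡ-< (m / n * n) (m%n<n m n) ⟩
  n + m / n * n     ∎
  where open ≤-Reasoning

2*≤1+2*⇒≤ : ∀ {a b} → 2 * a ≤ 1 + 2 * b → a ≤ b
2*≤1+2*⇒≤ {a} {b} le = *-cancelˡ-≤ 2 (≤-pred (≤∧≢⇒< le (even≢odd a b)))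

fromBit-< : ∀ {p q} → fromBit p < fromBit q → p ≡ false × q ≡ true
fromBit-< {false} {true}  _         = refl , refl
fromBit-< {true}  {true}  (s≤s ())
fromBit-< {true}  {false} ()

same-half∧<⇒bits : ∀ {v y} → v / 2 ≡ y / 2 → v < y → bit v ≡ false × bit y ≡ true
same-half∧<⇒bits {v} {y} same v<y =
  fromBit-< (+-cancelʳ-< (2 * (y / 2)) _ _ (subst₂ _<_ v≡ (sym (bit∷ᵇhalf y)) v<y))
  where
  v≡ : v ≡ bit v ∷ᵇ y / 2
  v≡ = trans (sym (bit∷ᵇhalf v)) (cong (bit v ∷ᵇ_) same)

odd*odd : ∀ m t → suc (2 * m) * suc (2 * t) ≡ suc (2 * (m + t + 2 * m * t))
odd*odd = solve-∀

[4m+3]*y : ∀ m y → y * suc (4 * m + 2) ≡ y + 2 * (suc (2 * m) * y)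
[4m+3]*y = solve-∀

[4m+3]*suc[v] : ∀ m v → suc v * suc (4 * m + 2) ≡ v + suc (2 * (suc (2 * m) * suc v))
[4m+3]*suc[v] = solve-∀

module _ (m : ℕ) where

  private
    j k : ℕ
    j = suc (2 * m)
    k = suc (4 * m + 2)

  ≤fk⇒*≤ : ∀ x z {y a} → x + z ≡ y + 2 * a → y ≤ fk m x z → j * y ≤ a
  ≤fk⇒*≤ x z {y} {a} x+z≡ y≤ = *-cancelˡ-≤ 2 (+-cancelˡ-≤ y _ _ (begin
    y + 2 * (j * y) ≡⟨ sym ([4m+3]*y m y) ⟩
    y * k           ≤⟨ *-monoˡ-≤ k y≤ ⟩
    fk m x z * k    ≤⟨ m/n*n≤m (x + z) k ⟩
    x + z           ≡⟨ x+z≡ ⟩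
    y + 2 * a       ∎))
    where open ≤-Reasoning

  ≡fk⇒≤*suc : ∀ u z {v a} → u + z ≡ v + 2 * a → v ≡ fk m u z → a ≤ j * suc v
  ≡fk⇒≤*suc u z {v} {a} u+z≡ v≡ = *-cancelˡ-≤ 2 (≤-pred (+-cancelˡ-< v _ _ (begin-strict
    v + 2 * a                   ≡⟨ sym u+z≡ ⟩
    u + z                       <⟨ m<suc[m/n]*n (u + z) k ⟩
    suc (fk m u z) * k          ≡⟨ cong (λ t → suc t * k) (sym v≡) ⟩
    suc v * k                   ≡⟨ [4m+3]*suc[v] m v ⟩
    v + suc (2 * (j * suc v))   ∎)))
    where open ≤-Reasoning

  halve-lower : ∀ x {y} → j * y ≤ x ∖ y → j * (y / 2) ≤ x / 2 ∖ y / 2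
  halve-lower x {y} lower = 2*≤1+2*⇒≤ (begin
    2 * (j * (y / 2))                     ≡⟨ regroup j (y / 2) ⟩
    j * (2 * (y / 2))                     ≤⟨ *-monoʳ-≤ j (m≤n+m (2 * (y / 2)) (fromBit (bit y))) ⟩
    j * (bit y ∷ᵇ y / 2)                  ≡⟨ cong (j *_) (bit∷ᵇhalf y) ⟩
    j * y                                 ≤⟨ lower ⟩
    x ∖ y                                 ≡⟨ ∖-unfold x y ⟩
    (bit x ∧ not (bit y)) ∷ᵇ (x / 2 ∖ y / 2) ≤⟨ ∷ᵇ≤1+2* (bit x ∧ not (bit y)) (x / 2 ∖ y / 2) ⟩
    1 + 2 * (x / 2 ∖ y / 2)               ∎)
    where
    open ≤-Reasoning
    regroup : ∀ i t → 2 * (i * t) ≡ i * (2 * t)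
    regroup = solve-∀

  halve-upper : ∀ u {v} → u ∖ v ≤ j * suc v → u / 2 ∖ v / 2 ≤ j * suc (v / 2)
  halve-upper u {v} upper = *-cancelˡ-≤ 2 (begin
    2 * (u / 2 ∖ v / 2)                      ≤⟨ m≤n+m (2 * (u / 2 ∖ v / 2)) (fromBit (bit u ∧ not (bit v))) ⟩
    (bit u ∧ not (bit v)) ∷ᵇ (u / 2 ∖ v / 2) ≡⟨ sym (∖-unfold u v) ⟩
    u ∖ v                                    ≤⟨ upper ⟩
    j * suc v                                ≡⟨ cong (λ w → j * suc w) (sym (bit∷ᵇhalf v)) ⟩
    j * suc (bit v ∷ᵇ v / 2)                 ≤⟨ *-monoʳ-≤ j (s≤s (∷ᵇ≤1+2* (bit v) (v / 2))) ⟩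
    j * (2 + 2 * (v / 2))                    ≡⟨ regroup j (v / 2) ⟩
    2 * (j * suc (v / 2))                    ∎)
    where
    open ≤-Reasoning
    regroup : ∀ i t → i * (2 + 2 * t) ≡ 2 * (i * suc t)
    regroup = solve-∀

  -- Here y = 2t + 1 and v = 2t, so x ∖ y is even, while the two bounds squeeze it to the odd j * y.
  ∖-bounds-incompatible-at-last-bit : ∀ x u {y v} → v / 2 ≡ y / 2 → v < y → x / 2 ≡ u / 2 →
                                      j * y ≤ x ∖ y → u ∖ v ≤ j * suc v → ⊥
  ∖-bounds-incompatible-at-last-bit x u {y} {v} same v<y x≈u lower upper =
    even≢odd a (m + t + 2 * m * t) (trans (≤-antisym 2a≤jy jy≤2a) (trans (cong (j *_) y≡) (odd*odd m t)))
    where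
    t a : ℕ
    t = y / 2
    a = x / 2 ∖ t
    bits : bit v ≡ false × bit y ≡ true
    bits = same-half∧<⇒bits same v<y
    y≡ : y ≡ true ∷ᵇ t
    y≡ = trans (sym (bit∷ᵇhalf y)) (cong (_∷ᵇ t) (proj₂ bits))
    v≡ : v ≡ false ∷ᵇ t
    v≡ = trans (sym (bit∷ᵇhalf v)) (cong₂ _∷ᵇ_ (proj₁ bits) same)
    x∖y≡ : x ∖ y ≡ 2 * a
    x∖y≡ = begin
      x ∖ y                          ≡⟨ ∖-unfold x y ⟩
      (bit x ∧ not (bit y)) ∷ᵇ a     ≡⟨ cong (λ b → (bit x ∧ not b) ∷ᵇ a) (proj₂ bits) ⟩
      (bit x ∧ false) ∷ᵇ a           ≡⟨ cong (_∷ᵇ a) (∧-zeroʳ (bit x)) ⟩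
      2 * a                          ∎
      where open ≡-Reasoning
    2a≤jy : 2 * a ≤ j * y
    2a≤jy = begin
      2 * a                                    ≡⟨ cong₂ (λ p q → 2 * (p ∖ q)) x≈u (sym same) ⟩
      2 * (u / 2 ∖ v / 2)                      ≤⟨ m≤n+m (2 * (u / 2 ∖ v / 2)) (fromBit (bit u ∧ not (bit v))) ⟩
      (bit u ∧ not (bit v)) ∷ᵇ (u / 2 ∖ v / 2) ≡⟨ sym (∖-unfold u v) ⟩
      u ∖ v                                    ≤⟨ upper ⟩
      j * suc v                                ≡⟨ cong (λ w → j * suc w) v≡ ⟩
      j * (true ∷ᵇ t)                          ≡⟨ cong (j *_) (sym y≡) ⟩
      j * y                                    ∎
      where open ≤-Reasoning
    jy≤2a : j * y ≤ 2 * a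
    jy≤2a = subst (j * y ≤_) x∖y≡ lower

  halves-agree : ∀ {x y u v} → v / 2 ≡ y / 2 → x ≡ u ⊎ x ⊕ y ≡ u ⊕ v → x / 2 ≡ u / 2
  halves-agree {x} {y} {u} {v} same = [ cong (_/ 2) , via-⊕ ]
    where
    via-⊕ : x ⊕ y ≡ u ⊕ v → x / 2 ≡ u / 2
    via-⊕ e = ⊕-cancelʳ (x / 2) (u / 2) (y / 2) (begin
      x / 2 ⊕ y / 2 ≡⟨ sym (⊕-half x y) ⟩
      (x ⊕ y) / 2   ≡⟨ cong (_/ 2) e ⟩
      (u ⊕ v) / 2   ≡⟨ ⊕-half u v ⟩
      u / 2 ⊕ v / 2 ≡⟨ cong (u / 2 ⊕_) same ⟩
      u / 2 ⊕ y / 2 ∎)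
      where open ≡-Reasoning

  halve-link : ∀ {x y u v} → x ≡ u ⊎ x ⊕ y ≡ u ⊕ v → x / 2 ≡ u / 2 ⊎ x / 2 ⊕ y / 2 ≡ u / 2 ⊕ v / 2
  halve-link {x} {y} {u} {v} =
    [ inj₁ ∘ cong (_/ 2) , (λ e → inj₂ (trans (sym (⊕-half x y)) (trans (cong (_/ 2) e) (⊕-half u v)))) ]

  -- Halving preserves every hypothesis; descend until y and v differ only in their last bit.
  ∖-bounds-incompatible : ∀ x u {y v} → v < y → x ≡ u ⊎ x ⊕ y ≡ u ⊕ v →
                          j * y ≤ x ∖ y → u ∖ v ≤ j * suc v → ⊥
  ∖-bounds-incompatible x u {y} = bounded y x u ≤-refl
    where
    bounded : ∀ n x u {y v} → y ≤ n → v < y → x ≡ u ⊎ x ⊕ y ≡ u ⊕ v →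
              j * y ≤ x ∖ y → u ∖ v ≤ j * suc v → ⊥
    bounded zero    _ _ z≤n ()
    bounded (suc n) x u {y} {v} y≤ v<y link lower upper with v / 2 ≟ y / 2
    ... | yes same   = ∖-bounds-incompatible-at-last-bit x u same v<y (halves-agree same link) lower upper
    ... | no  differ = bounded n (x / 2) (u / 2) (m≤1+n⇒m/2≤n y≤) (≤∧≢⇒< (/-monoˡ-≤ 2 (<⇒≤ v<y)) differ)
                         (halve-link link) (halve-lower x lower) (halve-upper u upper)

lemma2p10 : (m x y z : ℕ) → x ⊕ y ⊕ z ≡ 0 → y ≤ fk m x z →
    ((u : ℕ) → u < x → u ⊕ y ⊕ z ≢ 0)
    × ((u v : ℕ) → u < x → v < y → v ≡ fk m u z → u ⊕ v ⊕ z ≢ 0)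
    × ((v : ℕ) → v < y → x ⊕ v ⊕ z ≢ 0)
    × ((w : ℕ) → w < z → y ≤ fk m x w → x ⊕ y ⊕ w ≢ 0)
    × ((v w : ℕ) → v < y → w < z → v ≡ fk m x w → x ⊕ v ⊕ w ≢ 0)
lemma2p10 m x y z x⊕y⊕z≡0 y≤fk =
  (λ u u<x e → <-irrefl (⊕-cancelʳ u x y (trans (⊕≡0⇒≡ e) (sym x⊕y≡z))) u<x) ,
  (λ u v u<x v<y v≡fk e →
    ∖-bounds-incompatible m x u v<y (inj₂ (trans x⊕y≡z (sym (⊕≡0⇒≡ e)))) lower (upper u v z e v≡fk)) ,
  (λ v v<y e → <-irrefl (⊕-cancelˡ v y x (trans (⊕≡0⇒≡ e) (sym x⊕y≡z))) v<y) ,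
  (λ w w<z _ e → <-irrefl (trans (sym (⊕≡0⇒≡ e)) x⊕y≡z) w<z) ,
  (λ v w v<y w<z v≡fk e →
    ∖-bounds-incompatible m x x v<y (inj₁ refl) lower (upper x v w e v≡fk))
  where
  x⊕y≡z : x ⊕ y ≡ z
  x⊕y≡z = ⊕≡0⇒≡ x⊕y⊕z≡0
  lower : suc (2 * m) * y ≤ x ∖ y
  lower = ≤fk⇒*≤ m x z (m⊕n≡o⇒m+o≡n+2*[m∖n] x y x⊕y≡z) y≤fk
  upper : ∀ u v w → u ⊕ v ⊕ w ≡ 0 → v ≡ fk m u w → u ∖ v ≤ suc (2 * m) * suc v
  upper u v w e = ≡fk⇒≤*suc m u w (m⊕n≡o⇒m+o≡n+2*[m∖n] u v (⊕≡0⇒≡ e))
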